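{- Let $d\in\mathbb{N}$. For every $n\in\{d,d+1,\dots,2^d-1\}$ there exist a set $S$ equipped with a map $s\mapsto s'$ satisfying $s''=s$ and $s'\neq s$ for all $s\in S$, and a cube tiling code $V\subset S^d$, such that $\sum_{i=1}^d l_i=n$, where $l_i=|\{v_i\colon v\in V\}|/2$ for $i\in[d]$.
   Context: Let $S$ be a set with a map $s\mapsto s'$ such that $s''=(s')'=s$ and $s'\neq s$ for all $s\in S$. Elements of $S^d$ are words $v=v_1\dots v_d$. Two words $v,w\in S^d$ are dichotomous if there is $i\in[d]$ with $v_i=w_i'$. A set $V\subset S^d$ is a cube tiling code if every two distinct words of $V$ are dichotomous and $|V|=2^d$. -}

module Defs where

open import Data.Nat using (ℕ; _*_; _^_)
open import Data.Fin using (Fin)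
open import Data.Vec using (Vec; lookup)
open import Data.List using (List; length)
open import Data.Nat.ListAction using (sum)
open import Data.List.Relation.Unary.Unique.Propositional using (Unique)
open import Data.List.Membership.Propositional using (_∈_)
open import Data.Product using (Σ; ∃; _×_; ∃-syntax)
open import Relation.Binary.PropositionalEquality using (_≡_)
open import Relation.Nullary using (¬_)
open import Function.Bundles using (_⇔_)

record InvolutiveSet : Set₁ where
  field
    Carrier : Set
    _′      : Carrier → Carrier
    invol   : ∀ s → (s ′) ′ ≡ s
    nofix   : ∀ s → ¬ (s ′ ≡ s)

Word : Set → ℕ → Set
Word S d = Vec S d

Dichotomous : (S : InvolutiveSet) {d : ℕ} →
  Word (InvolutiveSet.Carrier S) d → Word (InvolutiveSet.Carrier S) d → Set
Dichotomous S v w = ∃[ i ] (lookup v i ≡ InvolutiveSet._′ S (lookup w i))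

IsCubeTilingCode : (S : InvolutiveSet) (d : ℕ) →
  List (Word (InvolutiveSet.Carrier S) d) → Set
IsCubeTilingCode S d V =
  Unique V ×
  length V ≡ 2 ^ d ×
  (∀ {v w} → v ∈ V → w ∈ V → ¬ (v ≡ w) → Dichotomous S v w)

CoordCard : {A : Set} {d : ℕ} → List (Vec A d) → Fin d → ℕ → Set
CoordCard {A} V i k =
  Σ (List A) λ L → Unique L × length L ≡ k ×
    (∀ x → (x ∈ L) ⇔ (∃[ v ] (v ∈ V × lookup v i ≡ x)))

sumFin : {d : ℕ} → (Fin d → ℕ) → ℕ
sumFin {d} f = sum (Data.List.map f (Data.List.allFin d))

{-# OPTIONS --safe #-}
module Submission where

-- Index the 2^d words by bit vectors w and let the i-th letter of the word of w be
-- (tᵢ(wᵢ₊₁ … w_d) , wᵢ), where s ↦ s' flips the bit and the label tᵢ only sees the later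
-- bits. Two distinct bit vectors then give words that are dichotomous at the last
-- coordinate where they differ, because the labels there agree. Coordinate i uses
-- 2 |im tᵢ| letters, and tᵢ(u) = min(value u, mᵢ - 1) realises any 1 ≤ mᵢ ≤ 2^(d-i);
-- such mᵢ with Σ mᵢ = n exist whenever d ≤ n < 2^d.

open import Defs
open import Data.Bool using (Bool; true; false; not; _≟_)
open import Data.Bool.Properties using (not-involutive; not-¬; ¬-not)
open import Data.Fin using (Fin; zero; suc)
open import Data.List using (List; []; _∷_; _++_; map; length; upTo; cartesianProductWith; cartesianProduct)
import Data.List.Properties as List
open import Data.List.Membership.Propositional using (_∈_)
open import Data.List.Membership.Propositional.Properties
open import Data.List.Relation.Unary.All using ([]; _∷_)
open import Data.List.Relation.Unary.AllPairs using ([]; _∷_)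
open import Data.List.Relation.Unary.Any using (here; there)
open import Data.List.Relation.Unary.Unique.Propositional using (Unique)
import Data.List.Relation.Unary.Unique.Propositional.Properties as Unique
open import Data.Nat using (ℕ; zero; suc; pred; _+_; _*_; _^_; _⊓_; _≤_; _<_; z≤n; s≤s; s≤s⁻¹; _<?_; _≤?_)
import Data.Nat.ListAction as ListAction
open import Data.Nat.Properties
  using ( +-identityʳ; +-comm; +-cancelˡ-<; *-comm; *-zeroʳ; *-distribˡ-+; m^n>0; +-commutativeSemigroup
        ; ≤-refl; ≤-trans; <-≤-trans; n≤1+n; m≤m+n; ≮⇒≥; ≰⇒>; m≤n⇒∃[o]m+o≡n; m⊓n≤n; m≤n⇒m⊓n≡m )
open import Algebra.Properties.CommutativeSemigroup +-commutativeSemigroup using (x∙yz≈y∙xz)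
open import Data.Product using (Σ; _×_; _,_; proj₂; map₂; ∃-syntax)
open import Data.Unit using (⊤; tt)
open import Data.Vec using (Vec; []; _∷_; lookup; sum; replicate)
import Data.Vec.Properties as Vec
open import Function using (_∘_; id)
open import Function.Bundles using (_⇔_; mk⇔; Equivalence)
open import Function.Construct.Composition using (_⇔-∘_)
open import Relation.Nullary using (yes; no; contradiction)
open import Relation.Binary.PropositionalEquality

open Equivalence using (to; from)

-- CoordCard V i k unfolds to HasCard (λ x → ∃[ v ] (v ∈ V × lookup v i ≡ x)) k.
HasCard : {A : Set} → (A → Set) → ℕ → Set
HasCard {A} P k = Σ (List A) λ L → Unique L × length L ≡ k × (∀ x → (x ∈ L) ⇔ P x)

HasCard-resp-⇔ : {A : Set} {P Q : A → Set} {k : ℕ} →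
  (∀ x → P x ⇔ Q x) → HasCard P k → HasCard Q k
HasCard-resp-⇔ P⇔Q (L , unique , length≡k , ∈⇔P) =
  L , unique , length≡k , λ x → P⇔Q x ⇔-∘ ∈⇔P x

length-cartesianProductWith : {A B C : Set} (f : A → B → C) (xs : List A) (ys : List B) →
  length (cartesianProductWith f xs ys) ≡ length xs * length ys
length-cartesianProductWith f []       ys = refl
length-cartesianProductWith f (x ∷ xs) ys = begin
  length (map (f x) ys ++ cartesianProductWith f xs ys)
    ≡⟨ List.length-++ (map (f x) ys) ⟩
  length (map (f x) ys) + length (cartesianProductWith f xs ys)
    ≡⟨ cong₂ _+_ (List.length-map (f x) ys) (length-cartesianProductWith f xs ys) ⟩
  length ys + length xs * length ys ∎
  where open ≡-Reasoning

HasCard-× : {A B : Set} {P : A → Set} {Q : B → Set} {k l : ℕ} →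
  HasCard P k → HasCard Q l → HasCard (λ (a , b) → P a × Q b) (k * l)
HasCard-× (K , uniqueK , lengthK , ∈K⇔P) (L , uniqueL , lengthL , ∈L⇔Q) =
  cartesianProduct K L ,
  Unique.cartesianProduct⁺ uniqueK uniqueL ,
  trans (length-cartesianProductWith _,_ K L) (cong₂ _*_ lengthK lengthL) ,
  λ (a , b) → mk⇔
    (λ ab∈ → let a∈K , b∈L = ∈-cartesianProduct⁻ K L ab∈
             in to (∈K⇔P a) a∈K , to (∈L⇔Q b) b∈L)
    (λ (Pa , Qb) → ∈-cartesianProduct⁺ (from (∈K⇔P a) Pa) (from (∈L⇔Q b) Qb))

HasCard-< : ∀ m → HasCard (_< m) m
HasCard-< m = upTo m , Unique.upTo⁺ m , List.length-upTo m , λ j → mk⇔ ∈-upTo⁻ ∈-upTo⁺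

bools : List Bool
bools = true ∷ false ∷ []

∈-bools : ∀ b → b ∈ bools
∈-bools true  = here refl
∈-bools false = there (here refl)

bools-unique : Unique bools
bools-unique = ((λ ()) ∷ []) ∷ [] ∷ []

HasCard-Bool : HasCard (λ (_ : Bool) → ⊤) 2
HasCard-Bool = bools , bools-unique , refl , λ b → mk⇔ (λ _ → tt) (λ _ → ∈-bools b)

vectors : {A : Set} → List A → (d : ℕ) → List (Vec A d)
vectors xs zero    = [] ∷ []
vectors xs (suc d) = cartesianProductWith _∷_ xs (vectors xs d)

module _ {A : Set} (xs : List A) where

  length-vectors : ∀ d → length (vectors xs d) ≡ length xs ^ d
  length-vectors zero    = refl
  length-vectors (suc d) =
    trans (length-cartesianProductWith _∷_ xs (vectors xs d))
          (cong (length xs *_) (length-vectors d))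

  vectors⁺ : Unique xs → ∀ d → Unique (vectors xs d)
  vectors⁺ unique zero    = [] ∷ []
  vectors⁺ unique (suc d) =
    Unique.cartesianProductWith⁺ _∷_ Vec.∷-injective unique (vectors⁺ unique d)

  ∈-vectors : (∀ x → x ∈ xs) → ∀ {d} (v : Vec A d) → v ∈ vectors xs d
  ∈-vectors complete []      = here refl
  ∈-vectors complete (x ∷ v) = ∈-cartesianProductWith⁺ _∷_ (complete x) (∈-vectors complete v)

sumFin-suc : ∀ {d} (f : Fin (suc d) → ℕ) → sumFin f ≡ f zero + sumFin (f ∘ suc)
sumFin-suc f = cong (λ xs → f zero + ListAction.sum xs)
  (trans (List.map-tabulate suc f) (sym (List.map-tabulate id (f ∘ suc))))

sumFin-scaled-lookup : ∀ c {d} (ms : Vec ℕ d) → sumFin (λ i → c * lookup ms i) ≡ c * sum ms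
sumFin-scaled-lookup c []       = sym (*-zeroʳ c)
sumFin-scaled-lookup c (m ∷ ms) = begin
  sumFin (λ i → c * lookup (m ∷ ms) i)    ≡⟨ sumFin-suc (λ i → c * lookup (m ∷ ms) i) ⟩
  c * m + sumFin (λ i → c * lookup ms i)  ≡⟨ cong (c * m +_) (sumFin-scaled-lookup c ms) ⟩
  c * m + c * sum ms                       ≡⟨ *-distribˡ-+ c m (sum ms) ⟨
  c * (m + sum ms)                         ∎
  where open ≡-Reasoning

2^suc : ∀ d → 2 ^ suc d ≡ 2 ^ d + 2 ^ d
2^suc d = cong (2 ^ d +_) (+-identityʳ (2 ^ d))

value : ∀ {d} → Vec Bool d → ℕ
value []                 = 0
value (false ∷ w)        = value w
value {suc d} (true ∷ w) = 2 ^ d + value w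

value-surjective : ∀ d {j} → j < 2 ^ d → ∃[ w ] value {d} w ≡ j
value-surjective zero    {zero}  _        = [] , refl
value-surjective zero    {suc j} (s≤s ())
value-surjective (suc d) {j} j<2^[1+d] with j <? 2 ^ d
... | yes j<2^d = let w , value≡j = value-surjective d j<2^d in false ∷ w , value≡j
... | no j≮2^d with (r , refl) ← m≤n⇒∃[o]m+o≡n (≮⇒≥ j≮2^d) =
  let w , value≡r = value-surjective d r<2^d in true ∷ w , cong (2 ^ d +_) value≡r
  where
  r<2^d : r < 2 ^ d
  r<2^d = +-cancelˡ-< (2 ^ d) r (2 ^ d) (subst (2 ^ d + r <_) (2^suc d) j<2^[1+d])

image-clampedValue : ∀ {d m j} → 0 < m → m ≤ 2 ^ d → (∃[ w ] value {d} w ⊓ pred m ≡ j) ⇔ j < m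
image-clampedValue {d} {suc k} _ m≤2^d = mk⇔
  (λ { (w , refl) → s≤s (m⊓n≤n (value w) k) })
  (λ j<m → let w , value≡j = value-surjective d (<-≤-trans j<m m≤2^d)
           in w , trans (cong (_⊓ k) value≡j) (m≤n⇒m⊓n≡m (s≤s⁻¹ j<m)))

Signed : Set → InvolutiveSet
Signed A = record
  { Carrier = A × Bool
  ; _′      = map₂ not
  ; invol   = λ (a , b) → cong (a ,_) (not-involutive b)
  ; nofix   = λ (a , b) eq → not-¬ refl (sym (cong proj₂ eq))
  }

data TailMaps (A : Set) : ℕ → Set where
  []  : TailMaps A zero
  _∷_ : ∀ {d} → (Vec Bool d → A) → TailMaps A d → TailMaps A (suc d)

module _ {A : Set} where

  encode : ∀ {d} → TailMaps A d → Vec Bool d → Vec (A × Bool) d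
  encode []       []      = []
  encode (t ∷ ts) (b ∷ w) = (t w , b) ∷ encode ts w

  encode-injective : ∀ {d} (ts : TailMaps A d) {w w′} → encode ts w ≡ encode ts w′ → w ≡ w′
  encode-injective []       {[]}    {[]}      _  = refl
  encode-injective (t ∷ ts) {b ∷ w} {b′ ∷ w′} eq =
    cong₂ _∷_ (cong proj₂ (Vec.∷-injectiveˡ eq)) (encode-injective ts (Vec.∷-injectiveʳ eq))

  encode-dichotomous : ∀ {d} (ts : TailMaps A d) {w w′} → w ≢ w′ →
    Dichotomous (Signed A) (encode ts w) (encode ts w′)
  encode-dichotomous []       {[]}    {[]}      w≢w′ = contradiction refl w≢w′
  encode-dichotomous (t ∷ ts) {b ∷ w} {b′ ∷ w′} bw≢b′w′ with Vec.≡-dec _≟_ w w′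
  ... | no w≢w′  = let i , eq = encode-dichotomous ts w≢w′ in suc i , eq
  ... | yes refl = zero , cong (t w ,_) (¬-not λ b≡b′ → bw≢b′w′ (cong (_∷ w) b≡b′))

  codeOf : ∀ {d} → TailMaps A d → List (Vec (A × Bool) d)
  codeOf {d} ts = map (encode ts) (vectors bools d)

  codeOf-isCubeTilingCode : ∀ {d} (ts : TailMaps A d) → IsCubeTilingCode (Signed A) d (codeOf ts)
  codeOf-isCubeTilingCode {d} ts =
    Unique.map⁺ (encode-injective ts) (vectors⁺ bools bools-unique d) ,
    trans (List.length-map (encode ts) (vectors bools d)) (length-vectors bools d) ,
    dichotomous
    where
    dichotomous : ∀ {v v′} → v ∈ codeOf ts → v′ ∈ codeOf ts → v ≢ v′ → Dichotomous (Signed A) v v′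
    dichotomous v∈ v′∈ v≢v′ with ∈-map⁻ (encode ts) v∈ | ∈-map⁻ (encode ts) v′∈
    ... | w , _ , refl | w′ , _ , refl = encode-dichotomous ts (v≢v′ ∘ cong (encode ts))

  Column : ∀ {d} → TailMaps A d → Fin d → A × Bool → Set
  Column ts i x = ∃[ w ] lookup (encode ts w) i ≡ x

  Column⇔∈-codeOf : ∀ {d} (ts : TailMaps A d) i x →
    Column ts i x ⇔ (∃[ v ] (v ∈ codeOf ts × lookup v i ≡ x))
  Column⇔∈-codeOf ts i x = mk⇔
    (λ (w , eq) → encode ts w , ∈-map⁺ (encode ts) (∈-vectors bools ∈-bools w) , eq)
    (λ { (v , v∈ , refl) → let w , _ , encode≡v = ∈-map⁻ (encode ts) v∈
                           in w , cong (λ u → lookup u i) (sym encode≡v) })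

  Column-suc : ∀ {d} (t : Vec Bool d → A) (ts : TailMaps A d) i x →
    Column ts i x ⇔ Column (t ∷ ts) (suc i) x
  Column-suc t ts i x = mk⇔ (λ (w , eq) → true ∷ w , eq) (λ { (_ ∷ w , eq) → w , eq })

Admissible : ∀ {d} → Vec ℕ d → Set
Admissible []                = ⊤
Admissible {suc d} (m ∷ ms) = 0 < m × m ≤ 2 ^ d × Admissible ms

clampedValues : ∀ {d} → Vec ℕ d → TailMaps ℕ d
clampedValues []       = []
clampedValues (m ∷ ms) = (λ w → value w ⊓ pred m) ∷ clampedValues ms

HasCard-Column-clampedValues : ∀ {d} (ms : Vec ℕ d) → Admissible ms →
  ∀ i → HasCard (Column (clampedValues ms) i) (2 * lookup ms i)
HasCard-Column-clampedValues (m ∷ ms) (0<m , m≤2^d , _) zero =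
  subst (HasCard _) (*-comm m 2)
    (HasCard-resp-⇔ (λ (j , b) → letters j b) (HasCard-× (HasCard-< m) HasCard-Bool))
  where
  letters : ∀ j b → (j < m × ⊤) ⇔ Column (clampedValues (m ∷ ms)) zero (j , b)
  letters j b = mk⇔
    (λ (j<m , _) → let w , eq = from (image-clampedValue 0<m m≤2^d) j<m in b ∷ w , cong (_, b) eq)
    (λ { (_ ∷ w , refl) → to (image-clampedValue 0<m m≤2^d) (w , refl) , tt })
HasCard-Column-clampedValues (m ∷ ms) (_ , _ , admissible) (suc i) =
  HasCard-resp-⇔ (Column-suc _ (clampedValues ms) i) (HasCard-Column-clampedValues ms admissible i)

replicate-1-admissible : ∀ d → Admissible (replicate d 1)
replicate-1-admissible zero    = tt
replicate-1-admissible (suc d) = s≤s z≤n , m^n>0 2 d , replicate-1-admissible d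

sum-replicate-1 : ∀ d → sum (replicate d 1) ≡ d
sum-replicate-1 zero    = refl
sum-replicate-1 (suc d) = cong suc (sum-replicate-1 d)

-- Either the first coordinate takes everything beyond a 1 on each later coordinate,
-- or it is saturated at 2^e and the rest is decomposed recursively.
admissible-decomposition : ∀ d n → d ≤ n → n < 2 ^ d → ∃[ ms ] (Admissible {d} ms × sum ms ≡ n)
admissible-decomposition zero    zero    _ _        = [] , tt , refl
admissible-decomposition zero    (suc n) _ (s≤s ())
admissible-decomposition (suc e) n 1+e≤n n<2^[1+e]
  with (j , refl) ← m≤n⇒∃[o]m+o≡n 1+e≤n | suc j ≤? 2 ^ e
... | yes 1+j≤2^e =
  suc j ∷ replicate e 1 , (s≤s z≤n , 1+j≤2^e , replicate-1-admissible e) ,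
  cong suc (trans (cong (j +_) (sum-replicate-1 e)) (+-comm j e))
... | no 1+j≰2^e with (r , refl) ← m≤n⇒∃[o]m+o≡n (s≤s⁻¹ (≰⇒> 1+j≰2^e)) =
  let ms , admissible , sum≡ = admissible-decomposition e (suc e + r) e≤ bound
  in 2 ^ e ∷ ms , (m^n>0 2 e , ≤-refl , admissible) ,
     trans (cong (2 ^ e +_) sum≡) (x∙yz≈y∙xz (2 ^ e) (suc e) r)
  where
  e≤ : e ≤ suc e + r
  e≤ = ≤-trans (n≤1+n e) (m≤m+n (suc e) r)
  bound : suc e + r < 2 ^ e
  bound = +-cancelˡ-< (2 ^ e) (suc e + r) (2 ^ e)
    (subst₂ _<_ (x∙yz≈y∙xz (suc e) (2 ^ e) r) (2^suc e) n<2^[1+e])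

lemma1 : (d n : ℕ) → d ≤ n → n < 2 ^ d →
    Σ InvolutiveSet λ S →
    Σ (List (Vec (InvolutiveSet.Carrier S) d)) λ V →
    IsCubeTilingCode S d V ×
    Σ (Fin d → ℕ) λ k →
      (∀ i → CoordCard V i (k i)) × sumFin k ≡ 2 * n
lemma1 d n d≤n n<2^d =
  let ms , admissible , sum≡n = admissible-decomposition d n d≤n n<2^d
      ts = clampedValues ms
  in Signed ℕ , codeOf ts , codeOf-isCubeTilingCode ts ,
     (λ i → 2 * lookup ms i) ,
     (λ i → HasCard-resp-⇔ (Column⇔∈-codeOf ts i) (HasCard-Column-clampedValues ms admissible i)) ,
     trans (sumFin-scaled-lookup 2 ms) (cong (2 *_) sum≡n)
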